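{- Consider a proof in $\mathcal{G}$ of the form: a tailless proof $\pi_1$ of $\Delta' \vdash A$ followed by applications of (W) yielding $\Delta \vdash A$, a tailless proof $\pi_2$ of $\Phi \vdash C$ followed by applications of (W) yielding $\Theta, B, \Gamma \vdash C$, and a final application of ($\rightarrow$L) with conclusion $\Theta, \Delta, A\rightarrow B, \Gamma \vdash C$. Then this proof can be transformed into a W-normal proof of the same degree of the form: a tailless proof $\pi$ of some $\Xi \vdash C$ followed by applications of (W) yielding $\Theta, \Delta, A \rightarrow B, \Gamma \vdash C$, such that for every occurrence $G$ of a formula in $\Theta$, if in the original proof there are $k$ applications of (W) above the right premise of ($\rightarrow$L) tied to (the occurrence corresponding to) $G$, then in the new proof there are $k$ applications of (W) tied to $G$. The same holds for occurrences of formulae in $\Gamma$.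
   Context: Formulae are built from propositional variables and $\bot$ with the binary connectives $\wedge,\vee,\rightarrow$. Sequents have the form $\Gamma \vdash C$, $\Gamma$ a finite (possibly empty) sequence of formulae, $C$ a formula. The system $\mathcal{G}$ has axioms $A \vdash A$ and $\bot \vdash A$ and rules: (C) from $\Delta, A, B, \Gamma \vdash C$ infer $\Delta, B, A, \Gamma \vdash C$; (W) from $\Theta, A, A, \Gamma \vdash C$ infer $\Theta, A, \Gamma \vdash C$; (K) from $\Theta, \Gamma \vdash C$ infer $\Theta, A, \Gamma \vdash C$; (cut) from $\Delta \vdash A$ and $\Theta, A, \Gamma \vdash C$ infer $\Theta, \Delta, \Gamma \vdash C$; ($\wedge$L) from $\Theta, A, \Gamma \vdash C$ (resp. $\Theta, B, \Gamma \vdash C$) infer $\Theta, A\wedge B, \Gamma \vdash C$; ($\wedge$R) from $\Gamma \vdash A$ and $\Gamma \vdash B$ infer $\Gamma \vdash A \wedge B$; ($\vee$L) from $\Theta, A, \Gamma \vdash C$ and $\Theta, B, \Gamma \vdash C$ infer $\Theta, A \vee B, \Gamma \vdash C$; ($\vee$R) from $\Gamma \vdash A$ (resp. $\Gamma \vdash B$) infer $\Gamma \vdash A \vee B$; ($\rightarrow$L) from $\Delta \vdash A$ and $\Theta, B, \Gamma \vdash C$ infer $\Theta, \Delta, A \rightarrow B, \Gamma \vdash C$; ($\rightarrow$R) from $A, \Gamma \vdash B$ infer $\Gamma \vdash A \rightarrow B$. The degree of a cut is the number of binary connectives in its cut formula; the degree of a proof is the maximal degree of its cuts (0 if none). Clusters: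 in each inference, each occurrence of a formula in the antecedent of the conclusion lying in a context sequence ($\Theta,\Delta,\Gamma$ of the schema) has as immediate ancestors the occurrences at the corresponding place in the premise(s); in (C) the displayed $B,A$ of the conclusion have as immediate ancestors the displayed $B,A$ of the premise; in (W) the displayed contracted occurrence of $A$ in the conclusion has both displayed occurrences of $A$ of the premise as immediate ancestors. The cluster of an occurrence $G$ is the set of occurrences obtained from $G$ by iterating the immediate-ancestor relation (including $G$). An application of (W) in a proof of $\Gamma \vdash C$ is tied to an occurrence $G$ of a formula in $\Gamma$ iff the principal (contracted) occurrence in the conclusion of this application belongs to the cluster of $G$. A proof is W-normal iff every application of (W) in it either is the last rule of the proof, or has only applications of (W) below it, or is the upper rule in one of the two contexts: (i) $\Theta, A, A, A, \Gamma \vdash C$ by (W) to $\Theta, A, A, \Gamma \vdash C$ followed by (W) to $\Theta, A, \Gamma \vdash C$; (ii) $A, A, \Gamma \vdash B$ by (W) to $A, \Gamma \vdash B$ followed by ($\rightarrow$R) to $\Gamma \vdash A \rightarrow B$. A W-normal proof is tailless iff its last rule is not (W). -}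

module Defs where

open import Data.Nat using (ℕ; zero; suc; _+_; _∸_; _⊔_; _<ᵇ_; _≡ᵇ_)
open import Data.List using (List; []; _∷_; _++_; length)
open import Data.Bool using (Bool; true; false; if_then_else_; _∧_)
open import Data.Product using (_×_)
open import Data.Sum using (_⊎_)
open import Data.Unit using (⊤)
open import Data.Empty using (⊥)
open import Relation.Binary.PropositionalEquality using (_≡_)

infixr 6 _∧'_
infixr 5 _∨'_
infixr 4 _⇒_

data Fm : Set where
  var  : ℕ → Fm
  bot  : Fm
  _∧'_ : Fm → Fm → Fm
  _∨'_ : Fm → Fm → Fm
  _⇒_  : Fm → Fm → Fm

size : Fm → ℕ
size (var _)  = 0
size bot      = 0
size (A ∧' B) = suc (size A + size B)
size (A ∨' B) = suc (size A + size B)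
size (A ⇒ B)  = suc (size A + size B)

-- Proofs (derivations) in the system G of  Γ ⊢ C.
-- The context sequences of each rule schema are stored as (implicit)
-- arguments, so positions of occurrences are determined.

data Proof : List Fm → Fm → Set where
  ax   : ∀ {A} → Proof (A ∷ []) A
  botL : ∀ {A} → Proof (bot ∷ []) A
  exch : ∀ {Δ A B Γ C} → Proof (Δ ++ A ∷ B ∷ Γ) C → Proof (Δ ++ B ∷ A ∷ Γ) C
  weak : ∀ {Θ A Γ C} → Proof (Θ ++ A ∷ A ∷ Γ) C → Proof (Θ ++ A ∷ Γ) C     -- rule (W)
  thin : ∀ {Θ A Γ C} → Proof (Θ ++ Γ) C → Proof (Θ ++ A ∷ Γ) C             -- rule (K)
  cut  : ∀ {Δ A Θ Γ C} → Proof Δ A → Proof (Θ ++ A ∷ Γ) C → Proof (Θ ++ Δ ++ Γ) C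
  andL₁ : ∀ {Θ A B Γ C} → Proof (Θ ++ A ∷ Γ) C → Proof (Θ ++ (A ∧' B) ∷ Γ) C
  andL₂ : ∀ {Θ A B Γ C} → Proof (Θ ++ B ∷ Γ) C → Proof (Θ ++ (A ∧' B) ∷ Γ) C
  andR : ∀ {Γ A B} → Proof Γ A → Proof Γ B → Proof Γ (A ∧' B)
  orL  : ∀ {Θ A B Γ C} → Proof (Θ ++ A ∷ Γ) C → Proof (Θ ++ B ∷ Γ) C → Proof (Θ ++ (A ∨' B) ∷ Γ) C
  orR₁ : ∀ {Γ A B} → Proof Γ A → Proof Γ (A ∨' B)
  orR₂ : ∀ {Γ A B} → Proof Γ B → Proof Γ (A ∨' B)
  impL : ∀ {Δ A Θ B Γ C} → Proof Δ A → Proof (Θ ++ B ∷ Γ) C → Proof (Θ ++ Δ ++ (A ⇒ B) ∷ Γ) C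
  impR : ∀ {A Γ B} → Proof (A ∷ Γ) B → Proof Γ (A ⇒ B)

degree : ∀ {Γ C} → Proof Γ C → ℕ
degree ax = 0
degree botL = 0
degree (exch p) = degree p
degree (weak p) = degree p
degree (thin p) = degree p
degree (cut {A = A} p q) = size A ⊔ (degree p ⊔ degree q)
degree (andL₁ p) = degree p
degree (andL₂ p) = degree p
degree (andR p q) = degree p ⊔ degree q
degree (orL p q) = degree p ⊔ degree q
degree (orR₁ p) = degree p
degree (orR₂ p) = degree p
degree (impL p q) = degree p ⊔ degree q
degree (impR p) = degree p

-- Occurrences in the antecedent of the end-sequent are given by their
-- position i (0-based).  tiedW p i counts the applications of (W) in p
-- whose principal (contracted) occurrence lies in the cluster of the
-- occurrence at position i, following the immediate-ancestor relation
-- of the paper: context occurrences go to the corresponding place in the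
-- premise(s), (C) swaps the displayed pair, the contracted occurrence of
-- (W) has both displayed occurrences as ancestors, and principal
-- occurrences of other rules (and weakened formulae of (K)) have none.
-- (Each premise occurrence has at most one descendant, so the cluster is
-- a tree and the count below counts each (W) of the cluster once.)

tiedW : ∀ {Γ C} → Proof Γ C → ℕ → ℕ
tiedW ax i = 0
tiedW botL i = 0
tiedW (exch {Δ = Δ} p) i =
  if i ≡ᵇ length Δ then tiedW p (suc i)
  else if i ≡ᵇ suc (length Δ) then tiedW p (length Δ)
  else tiedW p i
tiedW (weak {Θ = Θ} p) i =
  if i <ᵇ length Θ then tiedW p i
  else if i ≡ᵇ length Θ then suc (tiedW p i + tiedW p (suc i))
  else tiedW p (suc i)
tiedW (thin {Θ = Θ} p) i =
  if i <ᵇ length Θ then tiedW p i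
  else if i ≡ᵇ length Θ then 0
  else tiedW p (i ∸ 1)
tiedW (cut {Δ = Δ} {Θ = Θ} p q) i =
  if i <ᵇ length Θ then tiedW q i
  else if i <ᵇ length Θ + length Δ then tiedW p (i ∸ length Θ)
  else tiedW q (suc (i ∸ length Δ))
tiedW (andL₁ {Θ = Θ} p) i = if i ≡ᵇ length Θ then 0 else tiedW p i
tiedW (andL₂ {Θ = Θ} p) i = if i ≡ᵇ length Θ then 0 else tiedW p i
tiedW (andR p q) i = tiedW p i + tiedW q i
tiedW (orL {Θ = Θ} p q) i = if i ≡ᵇ length Θ then 0 else tiedW p i + tiedW q i
tiedW (orR₁ p) i = tiedW p i
tiedW (orR₂ p) i = tiedW p i
tiedW (impL {Δ = Δ} {Θ = Θ} p q) i =
  if i <ᵇ length Θ then tiedW q i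
  else if i <ᵇ length Θ + length Δ then tiedW p (i ∸ length Θ)
  else if i ≡ᵇ length Θ + length Δ then 0
  else tiedW q (i ∸ length Δ)
tiedW (impR p) i = tiedW p (suc i)

data Below : Set where
  atRoot  : Below
  belowW  : ℕ → Below     -- an application of (W) with |Θ| = n
  belowR  : Below
  belowOt : Below

isW : ∀ {Γ C} → Proof Γ C → Bool
isW (weak p) = true
isW _ = false

-- condition on an application of (W) with context Θ of length n, given
-- whether all rules below it are (W) and which rule is directly below.
WOk : Bool → Below → ℕ → Set
WOk true  _          n = ⊤
WOk false (belowW m) n = (n ≡ m) ⊎ (n ≡ suc m)
  -- context (i): Θ,A,A,A,Γ ⇒W Θ,A,A,Γ ⇒W Θ,A,Γ ; the upper (W)
  -- contracts two of the three displayed A's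
WOk false belowR     n = n ≡ 0          -- context (ii): A,A,Γ ⇒W A,Γ ⇒→R
WOk false _          n = ⊥

WN : ∀ {Γ C} → Bool → Below → Proof Γ C → Set
WN a b ax = ⊤
WN a b botL = ⊤
WN a b (exch p) = WN false belowOt p
WN a b (weak {Θ = Θ} p) = WOk a b (length Θ) × WN a (belowW (length Θ)) p
WN a b (thin p) = WN false belowOt p
WN a b (cut p q) = WN false belowOt p × WN false belowOt q
WN a b (andL₁ p) = WN false belowOt p
WN a b (andL₂ p) = WN false belowOt p
WN a b (andR p q) = WN false belowOt p × WN false belowOt q
WN a b (orL p q) = WN false belowOt p × WN false belowOt q
WN a b (orR₁ p) = WN false belowOt p
WN a b (orR₂ p) = WN false belowOt p
WN a b (impL p q) = WN false belowOt p × WN false belowOt q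
WN a b (impR p) = WN false belowR p

WNormal : ∀ {Γ C} → Proof Γ C → Set
WNormal p = WN true atRoot p

Tailless : ∀ {Γ C} → Proof Γ C → Set
Tailless p = WNormal p × isW p ≡ false

data WTail : ∀ {Γ C} → Proof Γ C → Set where
  base : ∀ {Γ C} {p : Proof Γ C} → Tailless p → WTail p
  step : ∀ {Θ A Γ C} {p : Proof (Θ ++ A ∷ A ∷ Γ) C} → WTail p → WTail (weak {Θ} {A} {Γ} p)

{-# OPTIONS --safe #-}
-- The (W)s of the left premise, and those of the right premise acting inside Θ or Γ, simply
-- move below (→L).  A (W) contracting B is replaced by (→L) applied to each of the two copies of B,
-- followed by contractions of the two copies of Δ, A → B so obtained; this terminates by
-- induction on the number of (W)s tied to B.  The exchanges needed to bring those copies together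
-- are pushed up through the (W)-tails, and an exchange on top of a tailless proof leaves it
-- tailless.  No cut is introduced, so the degree is unchanged.  The ties are tracked as a profile
-- i ↦ tiedW π i, which (W) at position t transforms by mergeAt t and (C) at position k by
-- precomposition with swapAt k.

module Submission where

open import Defs
open import Data.Nat using (ℕ; zero; suc; _+_; _∸_; _⊔_; _<_; _≤_; _<ᵇ_; _≡ᵇ_; z≤n; s≤s)
open import Data.Nat.Properties
  using ( ≤-refl; ≤-trans; <-≤-trans; n<1+n; n≤1+n; m<n⇒m<1+n; m≤m+n; m≤n+m; +-monoʳ-≤; +-suc
        ; m+n∸n≡m; ⊔-assoc; ⊔-idem)
open import Data.Nat.Tactic.RingSolver using (solve-∀)
open import Data.Bool using (true; false; if_then_else_)
open import Data.List using (List; []; _∷_; _++_; length)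
open import Data.List.Properties
  using (++-assoc; ∷-injective; length-++; length-++-sucʳ; length-++-≤ˡ; ++-identityʳ)
open import Data.Product using (Σ; ∃-syntax; _×_; _,_)
open import Data.Unit using (tt)
open import Function using (_∘_)
open import Relation.Binary.PropositionalEquality
open ≡-Reasoning

Profile : Set
Profile = ℕ → ℕ

swapAt : ℕ → ℕ → ℕ
swapAt zero    zero          = 1
swapAt zero    (suc zero)    = 0
swapAt zero    (suc (suc i)) = suc (suc i)
swapAt (suc k) zero          = zero
swapAt (suc k) (suc i)       = suc (swapAt k i)

-- The contracted occurrence inherits the ties of both its ancestors, plus the (W) itself.
mergeAt : ℕ → Profile → Profile
mergeAt zero    φ zero    = suc (φ 0 + φ 1)
mergeAt zero    φ (suc i) = φ (suc (suc i))
mergeAt (suc t) φ zero    = φ zero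
mergeAt (suc t) φ (suc i) = mergeAt t (φ ∘ suc) i

swapAt-below : ∀ {k i} → i < k → swapAt k i ≡ i
swapAt-below {suc k} {zero}  _         = refl
swapAt-below {suc k} {suc i} (s≤s i<k) = cong suc (swapAt-below i<k)

swapAt-above : ∀ {k i} → suc k < i → swapAt k i ≡ i
swapAt-above {zero}  {suc zero}    (s≤s ())
swapAt-above {zero}  {suc (suc i)} _         = refl
swapAt-above {suc k} {suc i}       (s≤s k<i) = cong suc (swapAt-above k<i)

mergeAt-below : ∀ {t i} (φ : Profile) → i < t → mergeAt t φ i ≡ φ i
mergeAt-below {suc t} {zero}  φ _         = refl
mergeAt-below {suc t} {suc i} φ (s≤s i<t) = mergeAt-below (φ ∘ suc) i<t

mergeAt-here : ∀ t (φ : Profile) → mergeAt t φ t ≡ suc (φ t + φ (suc t))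
mergeAt-here zero    φ = refl
mergeAt-here (suc t) φ = mergeAt-here t (φ ∘ suc)

mergeAt-above : ∀ {t i} (φ : Profile) → t < i → mergeAt t φ i ≡ φ (suc i)
mergeAt-above {zero}  {suc i} φ _         = refl
mergeAt-above {suc t} {suc i} φ (s≤s t<i) = mergeAt-above (φ ∘ suc) t<i

mergeAt-+ : ∀ a t (φ : Profile) i → mergeAt (a + t) φ (a + i) ≡ mergeAt t (φ ∘ (a +_)) i
mergeAt-+ zero    t φ i = refl
mergeAt-+ (suc a) t φ i = mergeAt-+ a t (φ ∘ suc) i

mergeAt-cong : ∀ t {φ ψ : Profile} → φ ≗ ψ → mergeAt t φ ≗ mergeAt t ψ
mergeAt-cong zero    φ≗ψ zero    = cong₂ (λ x y → suc (x + y)) (φ≗ψ 0) (φ≗ψ 1)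
mergeAt-cong zero    φ≗ψ (suc i) = φ≗ψ (suc (suc i))
mergeAt-cong (suc t) φ≗ψ zero    = φ≗ψ zero
mergeAt-cong (suc t) φ≗ψ (suc i) = mergeAt-cong t (φ≗ψ ∘ suc) i

mergeAt-cong-below : ∀ s {t} {φ ψ : Profile} → (∀ {i} → i < suc t → φ i ≡ ψ i) →
                     ∀ {i} → i < t → mergeAt s φ i ≡ mergeAt s ψ i
mergeAt-cong-below zero    φ≈ψ {zero}  0<t       =
  cong₂ (λ x y → suc (x + y)) (φ≈ψ (s≤s z≤n)) (φ≈ψ (s≤s 0<t))
mergeAt-cong-below zero    φ≈ψ {suc i} (s≤s i<t) = φ≈ψ (s≤s (s≤s i<t))
mergeAt-cong-below (suc s) φ≈ψ {zero}  _         = φ≈ψ (s≤s z≤n)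
mergeAt-cong-below (suc s) φ≈ψ {suc i} (s≤s i<t) =
  mergeAt-cong-below s (λ { (s≤s j<t) → φ≈ψ (s≤s (s≤s j<t)) }) i<t

mergeAt-swapAt-disjointˡ : ∀ {t k} (φ : Profile) → t < k →
                           mergeAt t (φ ∘ swapAt (suc k)) ≗ mergeAt t φ ∘ swapAt k
mergeAt-swapAt-disjointˡ {zero}  {suc k} φ _         zero    = refl
mergeAt-swapAt-disjointˡ {zero}  {suc k} φ _         (suc i) = refl
mergeAt-swapAt-disjointˡ {suc t} {suc k} φ _         zero    = refl
mergeAt-swapAt-disjointˡ {suc t} {suc k} φ (s≤s t<k) (suc i) = mergeAt-swapAt-disjointˡ (φ ∘ suc) t<k i

mergeAt-swapAt-disjointʳ : ∀ {t k} (φ : Profile) → suc k < t →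
                           mergeAt t (φ ∘ swapAt k) ≗ mergeAt t φ ∘ swapAt k
mergeAt-swapAt-disjointʳ {suc zero}    {zero}  φ (s≤s ())
mergeAt-swapAt-disjointʳ {suc (suc t)} {zero}  φ _         zero          = refl
mergeAt-swapAt-disjointʳ {suc (suc t)} {zero}  φ _         (suc zero)    = refl
mergeAt-swapAt-disjointʳ {suc (suc t)} {zero}  φ _         (suc (suc i)) = refl
mergeAt-swapAt-disjointʳ {suc t}       {suc k} φ _         zero          = refl
mergeAt-swapAt-disjointʳ {suc t}       {suc k} φ (s≤s k<t) (suc i)       =
  mergeAt-swapAt-disjointʳ (φ ∘ suc) k<t i

mergeAt-swapAt-left : ∀ k (φ : Profile) →
                      mergeAt (suc k) (φ ∘ swapAt (suc k) ∘ swapAt k) ≗ mergeAt k φ ∘ swapAt k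
mergeAt-swapAt-left zero    φ zero          = refl
mergeAt-swapAt-left zero    φ (suc zero)    = refl
mergeAt-swapAt-left zero    φ (suc (suc i)) = refl
mergeAt-swapAt-left (suc k) φ zero          = refl
mergeAt-swapAt-left (suc k) φ (suc i)       = mergeAt-swapAt-left k (φ ∘ suc) i

mergeAt-swapAt-right : ∀ k (φ : Profile) →
                       mergeAt k (φ ∘ swapAt k ∘ swapAt (suc k)) ≗ mergeAt (suc k) φ ∘ swapAt k
mergeAt-swapAt-right zero    φ zero          = refl
mergeAt-swapAt-right zero    φ (suc zero)    = refl
mergeAt-swapAt-right zero    φ (suc (suc i)) = refl
mergeAt-swapAt-right (suc k) φ zero          = refl
mergeAt-swapAt-right (suc k) φ (suc i)       = mergeAt-swapAt-right k (φ ∘ suc) i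

m≤m+n+o : ∀ m n o → m ≤ m + n + o
m≤m+n+o m n o = ≤-trans (m≤m+n m n) (m≤m+n (m + n) o)

record Matches (t a b : ℕ) (φ ψ : Profile) : Set where
  field
    prefix : ∀ {i} → i < t → φ i ≡ ψ i
    suffix : ∀ j → φ (a + j) ≡ ψ (b + j)
open Matches

Matches-refl : ∀ {t a φ} → Matches t a a φ φ
Matches-refl = record { prefix = λ _ → refl ; suffix = λ _ → refl }

Matches-respʳ : ∀ {t a b φ ψ ψ′} → ψ ≗ ψ′ → Matches t a b φ ψ → Matches t a b φ ψ′
Matches-respʳ ψ≗ψ′ m = record
  { prefix = λ i<t → trans (prefix m i<t) (ψ≗ψ′ _)
  ; suffix = λ j → trans (suffix m j) (ψ≗ψ′ _)
  }

Matches-mergeAt-prefix : ∀ {t a b s φ ψ} → s < a → s < b →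
                         Matches (suc t) (suc a) (suc b) φ ψ →
                         Matches t a b (mergeAt s φ) (mergeAt s ψ)
Matches-mergeAt-prefix {a = a} {b} {s} {φ} {ψ} s<a s<b m = record
  { prefix = mergeAt-cong-below s (prefix m)
  ; suffix = λ j → begin
      mergeAt s φ (a + j) ≡⟨ mergeAt-above φ (<-≤-trans s<a (m≤m+n a j)) ⟩
      φ (suc a + j)       ≡⟨ suffix m j ⟩
      ψ (suc b + j)       ≡⟨ mergeAt-above ψ (<-≤-trans s<b (m≤m+n b j)) ⟨
      mergeAt s ψ (b + j) ∎
  }

Matches-mergeAt-suffix : ∀ {t a b φ ψ} u → t ≤ a → t ≤ b → Matches t a b φ ψ →
                         Matches t a b (mergeAt (a + u) φ) (mergeAt (b + u) ψ)
Matches-mergeAt-suffix {t} {a} {b} {φ} {ψ} u t≤a t≤b m = record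
  { prefix = λ i<t → begin
      mergeAt (a + u) φ _ ≡⟨ mergeAt-below φ (<-≤-trans i<t (≤-trans t≤a (m≤m+n a u))) ⟩
      φ _                 ≡⟨ prefix m i<t ⟩
      ψ _                 ≡⟨ mergeAt-below ψ (<-≤-trans i<t (≤-trans t≤b (m≤m+n b u))) ⟨
      mergeAt (b + u) ψ _ ∎
  ; suffix = λ j → begin
      mergeAt (a + u) φ (a + j)  ≡⟨ mergeAt-+ a u φ j ⟩
      mergeAt u (φ ∘ (a +_)) j   ≡⟨ mergeAt-cong u (suffix m) j ⟩
      mergeAt u (ψ ∘ (b +_)) j   ≡⟨ mergeAt-+ b u ψ j ⟨
      mergeAt (b + u) ψ (b + j)  ∎
  }

Matches-mergeAt-left : ∀ {t d b s φ ψ} → t ≤ s → s ≤ t + d →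
                       Matches t (suc (t + suc d)) b φ ψ →
                       Matches t (suc (t + d)) b (mergeAt s φ) ψ
Matches-mergeAt-left {t} {d} {b} {s} {φ} {ψ} t≤s s≤t+d m = record
  { prefix = λ i<t → trans (mergeAt-below φ (<-≤-trans i<t t≤s)) (prefix m i<t)
  ; suffix = λ j → begin
      mergeAt s φ (suc (t + d) + j) ≡⟨ mergeAt-above φ (s≤s (≤-trans s≤t+d (m≤m+n (t + d) j))) ⟩
      φ (suc (suc (t + d)) + j)     ≡⟨ cong (λ a → φ (suc a + j)) (+-suc t d) ⟨
      φ (suc (t + suc d) + j)       ≡⟨ suffix m j ⟩
      ψ (b + j)                     ∎
  }

Matches-swapAt : ∀ {t e φ ψ} →
                 Matches (suc t) (suc (suc t) + e) (suc (suc t) + e) ψ φ →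
                 Matches t (suc t + suc e) (suc t + suc e) (ψ ∘ swapAt t) φ
Matches-swapAt {t} {e} {φ} {ψ} m = record
  { prefix = λ i<t → trans (cong ψ (swapAt-below i<t)) (prefix m (m<n⇒m<1+n i<t))
  ; suffix = λ j → begin
      ψ (swapAt t (suc t + suc e + j))   ≡⟨ cong (λ a → ψ (swapAt t (a + j))) (+-suc (suc t) e) ⟩
      ψ (swapAt t (suc (suc t) + e + j)) ≡⟨ cong ψ (swapAt-above (s≤s (s≤s (m≤m+n+o t e j)))) ⟩
      ψ (suc (suc t) + e + j)            ≡⟨ suffix m j ⟩
      φ (suc (suc t) + e + j)            ≡⟨ cong (λ a → φ (a + j)) (+-suc (suc t) e) ⟨
      φ (suc t + suc e + j)              ∎
  }

Matches-contract : ∀ {t e φ ψ₁ ψ} →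
                   Matches (suc t) (suc (suc t) + e) (suc (suc t) + e) ψ₁ φ →
                   Matches (suc t) (suc t + e) (suc t + (e + e)) ψ (mergeAt t ψ₁) →
                   Matches t (t + suc e) (t + (suc e + suc e)) ψ φ
Matches-contract {t} {e} {φ} {ψ₁} {ψ} m₁ m₂ = record
  { prefix = λ i<t → let i<1+t = m<n⇒m<1+n i<t in
      trans (prefix m₂ i<1+t) (trans (mergeAt-below ψ₁ i<t) (prefix m₁ i<1+t))
  ; suffix = λ j → begin
      ψ (t + suc e + j)                    ≡⟨ cong (λ a → ψ (a + j)) (+-suc t e) ⟩
      ψ (suc t + e + j)                    ≡⟨ suffix m₂ j ⟩
      mergeAt t ψ₁ (suc t + (e + e) + j)   ≡⟨ mergeAt-above ψ₁ (s≤s (m≤m+n+o t (e + e) j)) ⟩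
      ψ₁ (suc (suc t + (e + e) + j))       ≡⟨ cong ψ₁ (reassoc₁ t e j) ⟩
      ψ₁ (suc (suc t) + e + (e + j))       ≡⟨ suffix m₁ (e + j) ⟩
      φ (suc (suc t) + e + (e + j))        ≡⟨ cong φ (reassoc₂ t e j) ⟩
      φ (t + (suc e + suc e) + j)          ∎
  }
  where
  reassoc₁ : ∀ t e j → suc (suc t + (e + e) + j) ≡ suc (suc t) + e + (e + j)
  reassoc₁ = solve-∀
  reassoc₂ : ∀ t e j → suc (suc t) + e + (e + j) ≡ t + (suc e + suc e) + j
  reassoc₂ = solve-∀

Matches-duplicate : ∀ {t d ψ φ₁ φ₂ φ} →
                    Matches (suc t) (suc (suc t + d)) (suc (suc t)) φ₁ ψ →
                    Matches t (suc (t + d)) (suc t) φ₂ φ₁ →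
                    Matches t (t + suc d) (t + (suc d + suc d)) φ φ₂ →
                    Matches t (suc (t + d)) (suc t) φ (mergeAt t ψ)
Matches-duplicate {t} {d} {ψ} {φ₁} {φ₂} {φ} m₁ m₂ m₃ = record
  { prefix = λ i<t → trans (prefix m₃ i<t) (trans (prefix m₂ i<t)
               (trans (prefix m₁ (m<n⇒m<1+n i<t)) (sym (mergeAt-below ψ i<t))))
  ; suffix = λ j → begin
      φ (suc (t + d) + j)             ≡⟨ cong (λ a → φ (a + j)) (+-suc t d) ⟨
      φ (t + suc d + j)               ≡⟨ suffix m₃ j ⟩
      φ₂ (t + (suc d + suc d) + j)    ≡⟨ cong φ₂ (reassoc₁ t d j) ⟩
      φ₂ (suc (t + d) + (suc d + j))  ≡⟨ suffix m₂ (suc d + j) ⟩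
      φ₁ (suc t + (suc d + j))        ≡⟨ cong φ₁ (reassoc₂ t d j) ⟩
      φ₁ (suc (suc t + d) + j)        ≡⟨ suffix m₁ j ⟩
      ψ (suc (suc t) + j)             ≡⟨ mergeAt-above ψ (s≤s (m≤m+n t j)) ⟨
      mergeAt t ψ (suc t + j)         ∎
  }
  where
  reassoc₁ : ∀ t d j → t + (suc d + suc d) + j ≡ suc (t + d) + (suc d + j)
  reassoc₁ = solve-∀
  reassoc₂ : ∀ t d j → suc t + (suc d + j) ≡ suc (suc t + d) + j
  reassoc₂ = solve-∀

<ᵇ-true : ∀ {m n} → m < n → (m <ᵇ n) ≡ true
<ᵇ-true {zero}  (s≤s _)   = refl
<ᵇ-true {suc m} (s≤s m<n) = <ᵇ-true m<n

<ᵇ-false : ∀ {m n} → n ≤ m → (m <ᵇ n) ≡ false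
<ᵇ-false {zero}  z≤n       = refl
<ᵇ-false {suc m} z≤n       = refl
<ᵇ-false         (s≤s n≤m) = <ᵇ-false n≤m

≡ᵇ-false : ∀ {m n} → n < m → (m ≡ᵇ n) ≡ false
≡ᵇ-false {suc m} {zero}  _         = refl
≡ᵇ-false {suc m} {suc n} (s≤s n<m) = ≡ᵇ-false n<m

swapAt-if : ∀ k (φ : Profile) i →
            (if i ≡ᵇ k then φ (suc i) else if i ≡ᵇ suc k then φ k else φ i) ≡ φ (swapAt k i)
swapAt-if zero    φ zero          = refl
swapAt-if zero    φ (suc zero)    = refl
swapAt-if zero    φ (suc (suc i)) = refl
swapAt-if (suc k) φ zero          = refl
swapAt-if (suc k) φ (suc i)       = swapAt-if k (φ ∘ suc) i

mergeAt-if : ∀ t (φ : Profile) i →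
             (if i <ᵇ t then φ i else if i ≡ᵇ t then suc (φ i + φ (suc i)) else φ (suc i)) ≡ mergeAt t φ i
mergeAt-if zero    φ zero    = refl
mergeAt-if zero    φ (suc i) = refl
mergeAt-if (suc t) φ zero    = refl
mergeAt-if (suc t) φ (suc i) = mergeAt-if t (φ ∘ suc) i

tiedW-exch : ∀ {Δ A B Γ C} (p : Proof (Δ ++ A ∷ B ∷ Γ) C) →
             tiedW (exch {Δ} {A} {B} {Γ} p) ≗ tiedW p ∘ swapAt (length Δ)
tiedW-exch {Δ} p = swapAt-if (length Δ) (tiedW p)

tiedW-weak : ∀ {Θ A Γ C t} (p : Proof (Θ ++ A ∷ A ∷ Γ) C) → length Θ ≡ t →
             tiedW (weak {Θ} {A} {Γ} p) ≗ mergeAt t (tiedW p)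
tiedW-weak {Θ} p refl = mergeAt-if (length Θ) (tiedW p)

tiedW-weak-below : ∀ {Θ A Γ C t} (p : Proof (Θ ++ A ∷ A ∷ Γ) C) → t < length Θ →
                   tiedW (weak {Θ} {A} {Γ} p) t ≡ tiedW p t
tiedW-weak-below p t<s = trans (tiedW-weak p refl _) (mergeAt-below (tiedW p) t<s)

tiedW-weak-here : ∀ {Θ A Γ C t} (p : Proof (Θ ++ A ∷ A ∷ Γ) C) → length Θ ≡ t →
                  tiedW (weak {Θ} {A} {Γ} p) t ≡ suc (tiedW p t + tiedW p (suc t))
tiedW-weak-here {t = t} p len = trans (tiedW-weak p len t) (mergeAt-here t (tiedW p))

tiedW-weak-above : ∀ {Θ A Γ C t} (p : Proof (Θ ++ A ∷ A ∷ Γ) C) → length Θ < t →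
                   tiedW (weak {Θ} {A} {Γ} p) t ≡ tiedW p (suc t)
tiedW-weak-above p s<t = trans (tiedW-weak p refl _) (mergeAt-above (tiedW p) s<t)

tiedW-impL : ∀ {Δ A Θ B Γ C} (τ : Proof Δ A) (p : Proof (Θ ++ B ∷ Γ) C) →
             Matches (length Θ) (suc (length Θ + length Δ)) (suc (length Θ))
                     (tiedW (impL {Δ} {A} {Θ} {B} {Γ} τ p)) (tiedW p)
tiedW-impL {Δ} {Θ = Θ} τ p = record { prefix = prefix′ ; suffix = suffix′ }
  where
  t = length Θ
  d = length Δ
  prefix′ : ∀ {i} → i < t → tiedW (impL τ p) i ≡ tiedW p i
  prefix′ i<t rewrite <ᵇ-true i<t = refl
  suffix′ : ∀ j → tiedW (impL τ p) (suc (t + d) + j) ≡ tiedW p (suc t + j)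
  suffix′ j
    rewrite <ᵇ-false {suc (t + d) + j} {t} (≤-trans (m≤m+n+o t d j) (n≤1+n _))
          | <ᵇ-false {suc (t + d) + j} {t + d} (≤-trans (m≤m+n (t + d) j) (n≤1+n _))
          | ≡ᵇ-false {suc (t + d) + j} {t + d} (s≤s (m≤m+n (t + d) j))
          = cong (tiedW p) (trans (cong (_∸ d) (reassoc t d j)) (m+n∸n≡m (suc t + j) d))
    where
    reassoc : ∀ t d j → suc (t + d) + j ≡ suc t + j + d
    reassoc = solve-∀

WN-irrelevant : ∀ {Γ C} (p : Proof Γ C) → isW p ≡ false → ∀ {a b a′ b′} → WN a b p → WN a′ b′ p
WN-irrelevant ax         _ wn = wn
WN-irrelevant botL       _ wn = wn
WN-irrelevant (exch _)   _ wn = wn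
WN-irrelevant (thin _)   _ wn = wn
WN-irrelevant (cut _ _)  _ wn = wn
WN-irrelevant (andL₁ _)  _ wn = wn
WN-irrelevant (andL₂ _)  _ wn = wn
WN-irrelevant (andR _ _) _ wn = wn
WN-irrelevant (orL _ _)  _ wn = wn
WN-irrelevant (orR₁ _)   _ wn = wn
WN-irrelevant (orR₂ _)   _ wn = wn
WN-irrelevant (impL _ _) _ wn = wn
WN-irrelevant (impR _)   _ wn = wn

Tailless-exch : ∀ {Δ A B Γ C} {p : Proof (Δ ++ A ∷ B ∷ Γ) C} →
                Tailless p → Tailless (exch {Δ} {A} {B} {Γ} p)
Tailless-exch {p = p} (wn , notW) = WN-irrelevant p notW wn , refl

Tailless-impL : ∀ {Δ A Θ B Γ C} {τ : Proof Δ A} {p : Proof (Θ ++ B ∷ Γ) C} →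
                Tailless τ → Tailless p → Tailless (impL {Δ} {A} {Θ} {B} {Γ} τ p)
Tailless-impL {τ = τ} {p} (wnτ , notWτ) (wnp , notWp) =
  (WN-irrelevant τ notWτ wnτ , WN-irrelevant p notWp wnp) , refl

data WTailed : ℕ → ∀ {Γ C} → Proof Γ C → Set where
  base : ∀ {Γ C} {p : Proof Γ C} → Tailless p → WTailed 0 p
  step : ∀ {n Θ A Γ C} {p : Proof (Θ ++ A ∷ A ∷ Γ) C} →
         WTailed n p → WTailed (suc n) (weak {Θ} {A} {Γ} p)

WTail⇒WTailed : ∀ {Γ C} {p : Proof Γ C} → WTail p → ∃[ n ] WTailed n p
WTail⇒WTailed (base tl) = 0 , base tl
WTail⇒WTailed (step w)  = let n , w′ = WTail⇒WTailed w in suc n , step w′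

WTailed⇒WTail : ∀ {n Γ C} {p : Proof Γ C} → WTailed n p → WTail p
WTailed⇒WTail (base tl) = base tl
WTailed⇒WTail (step w)  = step (WTailed⇒WTail w)

WTailed⇒WN : ∀ {n Γ C} {p : Proof Γ C} → WTailed n p → ∀ {b} → WN true b p
WTailed⇒WN {p = p} (base (wn , notW)) = WN-irrelevant p notW wn
WTailed⇒WN         (step w)           = tt , WTailed⇒WN w

record TailProof (n : ℕ) (Ψ : List Fm) (C : Fm) (d : ℕ) (φ : Profile) : Set where
  constructor tailProof
  field
    proof   : Proof Ψ C
    tail    : WTailed n proof
    degree≡ : degree proof ≡ d
    tied≗   : tiedW proof ≗ φ
open TailProof

cast : ∀ {n Ψ Ψ′ C d φ} → Ψ ≡ Ψ′ → TailProof n Ψ C d φ → TailProof n Ψ′ C d φ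
cast refl r = r

retie : ∀ {n Ψ C d φ ψ} → φ ≗ ψ → TailProof n Ψ C d φ → TailProof n Ψ C d ψ
retie φ≗ψ (tailProof p w deg tied) = tailProof p w deg (λ i → trans (tied i) (φ≗ψ i))

redegree : ∀ {n Ψ C d d′ φ} → d ≡ d′ → TailProof n Ψ C d φ → TailProof n Ψ C d′ φ
redegree refl r = r

-- Positions come as t with length Θ ≡ t, so callers supply t in the arithmetic form they need.
appendW : ∀ Θ {A Γ n C d φ t} → length Θ ≡ t → TailProof n (Θ ++ A ∷ A ∷ Γ) C d φ →
          TailProof (suc n) (Θ ++ A ∷ Γ) C d (mergeAt t φ)
appendW Θ {t = t} len (tailProof p w deg tied) =
  tailProof (weak p) (step w) deg (λ i → trans (tiedW-weak p len i) (mergeAt-cong t tied i))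

data Locate (Θ′ Γ′ Θ Γ : List Fm) (Z B : Fm) : Set where
  before : ∀ M → Θ ≡ Θ′ ++ Z ∷ M → Γ′ ≡ M ++ B ∷ Γ → Locate Θ′ Γ′ Θ Γ Z B
  here   : Θ′ ≡ Θ → Z ≡ B → Γ′ ≡ Γ → Locate Θ′ Γ′ Θ Γ Z B
  after  : ∀ M → Θ′ ≡ Θ ++ B ∷ M → Γ ≡ M ++ Z ∷ Γ′ → Locate Θ′ Γ′ Θ Γ Z B

locate : ∀ Θ′ Θ {Z Γ′ B Γ} → Θ′ ++ Z ∷ Γ′ ≡ Θ ++ B ∷ Γ → Locate Θ′ Γ′ Θ Γ Z B
locate []       []      refl = here refl refl refl
locate []       (_ ∷ Θ) refl = before Θ refl refl
locate (_ ∷ Θ′) []      refl = after Θ′ refl refl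
locate (_ ∷ Θ′) (_ ∷ Θ) e with refl , e′ ← ∷-injective e with locate Θ′ Θ e′
... | before M refl refl = before M refl refl
... | here refl refl refl = here refl refl refl
... | after M refl refl = after M refl refl

length-snoc : ∀ (Θ : List Fm) {x t} → length Θ ≡ t → length (Θ ++ x ∷ []) ≡ suc t
length-snoc Θ {x} refl = trans (length-++-sucʳ Θ x []) (cong (suc ∘ length) (++-identityʳ Θ))

length-<-++ : ∀ (Θ : List Fm) {x xs} → length Θ < length (Θ ++ x ∷ xs)
length-<-++ Θ {x} {xs} = subst (length Θ <_) (sym (length-++-sucʳ Θ x xs)) (s≤s (length-++-≤ˡ Θ))

length-++-∷ : ∀ (Θ : List Fm) {x xs t} → length Θ ≡ t → length (Θ ++ x ∷ xs) ≡ suc t + length xs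
length-++-∷ Θ {xs = xs} {t} refl = trans (length-++ Θ) (+-suc t (length xs))

-- The tail length is preserved, which is what the nested calls in the cases here and after []
-- terminate on.
mutual
  exchangeWTailed : ∀ n {Ψ C} {p : Proof Ψ C} → WTailed n p →
                    ∀ Δ {X Y Γ k} → length Δ ≡ k → Ψ ≡ Δ ++ X ∷ Y ∷ Γ →
                    TailProof n (Δ ++ Y ∷ X ∷ Γ) C (degree p) (tiedW p ∘ swapAt k)
  exchangeWTailed zero {p = p} (base tl) Δ refl refl =
    tailProof (exch p) (base (Tailless-exch tl)) refl (tiedW-exch p)
  exchangeWTailed (suc n) (step {Θ = Θ} {A = Z} {Γ = Γ′} {p = p} w) Δ {X} {Y} {Γ} {k} len e
    with locate Θ Δ e
  ... | before M refl refl =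
    retie (λ i → trans (mergeAt-swapAt-disjointˡ (tiedW p) t<k i) (sym (tiedW-weak p refl (swapAt k i))))
      (cast (sym (++-assoc Θ (Z ∷ M) R))
        (appendW Θ refl
          (cast (++-assoc Θ (Z ∷ Z ∷ M) R)
            (exchangeWTailed n w (Θ ++ Z ∷ Z ∷ M) (trans (length-++-sucʳ Θ Z (Z ∷ M)) (cong suc len))
                             (sym (++-assoc Θ (Z ∷ Z ∷ M) (X ∷ Y ∷ Γ)))))))
    where
    R = Y ∷ X ∷ Γ
    t<k = subst (length Θ <_) len (length-<-++ Θ)
  ... | here refl refl refl =
    retie (λ i → trans (mergeAt-swapAt-left k (tiedW p) i) (sym (tiedW-weak p len (swapAt k i))))
      (cast (++-assoc Δ (Y ∷ []) (X ∷ Γ))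
        (appendW (Δ ++ Y ∷ []) (length-snoc Δ len)
          (cast (sym (++-assoc Δ (Y ∷ []) (X ∷ X ∷ Γ)))
            (exchange Δ len
              (cast (++-assoc Δ (X ∷ []) (Y ∷ X ∷ Γ))
                (exchangeWTailed n w (Δ ++ X ∷ []) (length-snoc Δ len)
                                 (sym (++-assoc Δ (X ∷ []) (X ∷ Y ∷ Γ)))))))))
  ... | after [] refl refl =
    retie (λ i → trans (mergeAt-swapAt-right k (tiedW p) i)
                       (sym (tiedW-weak p (length-snoc Δ len) (swapAt k i))))
      (appendW Δ len
        (cast (++-assoc Δ (Y ∷ []) (Y ∷ X ∷ Γ))
          (exchange (Δ ++ Y ∷ []) (length-snoc Δ len)
            (cast (sym (++-assoc Δ (Y ∷ []) (X ∷ Y ∷ Γ)))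
              (exchangeWTailed n w Δ len (++-assoc Δ (X ∷ []) (Y ∷ Y ∷ Γ)))))))
  ... | after (_ ∷ M) refl refl =
    retie (λ i → trans (mergeAt-swapAt-disjointʳ (tiedW p) k+1<t i) (sym (tiedW-weak p refl (swapAt k i))))
      (cast (++-assoc Δ (Y ∷ X ∷ M) (Z ∷ Γ′))
        (appendW (Δ ++ Y ∷ X ∷ M) (trans (length-++ Δ) (sym (length-++ Δ)))
          (cast (sym (++-assoc Δ (Y ∷ X ∷ M) (Z ∷ Z ∷ Γ′)))
            (exchangeWTailed n w Δ len (++-assoc Δ (X ∷ Y ∷ M) (Z ∷ Z ∷ Γ′))))))
    where
    k+1<t = subst (suc k <_) (sym (length-++-sucʳ Δ X (Y ∷ M))) (s≤s (subst (_< _) len (length-<-++ Δ)))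

  exchange : ∀ Δ {X Y Γ n C d φ k} → length Δ ≡ k → TailProof n (Δ ++ X ∷ Y ∷ Γ) C d φ →
             TailProof n (Δ ++ Y ∷ X ∷ Γ) C d (φ ∘ swapAt k)
  exchange Δ {n = n} {k = k} len (tailProof p w deg tied) =
    redegree deg (retie (tied ∘ swapAt k) (exchangeWTailed n w Δ len refl))

moveLeft : ∀ D {Θ x Γ n C d φ t} → length Θ ≡ t → TailProof n (Θ ++ D ++ x ∷ Γ) C d φ →
           ∃[ ψ ] TailProof n (Θ ++ x ∷ D ++ Γ) C d ψ
                × Matches t (suc t + length D) (suc t + length D) ψ φ
moveLeft [] len r = _ , r , Matches-refl
moveLeft (y ∷ D) {Θ} {x} {Γ} {t = t} len r =
  let ψ , r′ , m = moveLeft D {Θ ++ y ∷ []} (length-snoc Θ len)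
                            (cast (sym (++-assoc Θ (y ∷ []) (D ++ x ∷ Γ))) r)
  in ψ ∘ swapAt t , exchange Θ len (cast (++-assoc Θ (y ∷ []) (x ∷ D ++ Γ)) r′) , Matches-swapAt m

contract : ∀ D {Θ Γ n C d φ t} → length Θ ≡ t → TailProof n (Θ ++ D ++ D ++ Γ) C d φ →
           ∃[ k ] ∃[ ψ ] TailProof k (Θ ++ D ++ Γ) C d ψ
                       × Matches t (t + length D) (t + (length D + length D)) ψ φ
contract [] len r = _ , _ , r , Matches-refl
contract (x ∷ D) {Θ} {Γ} len r =
  let ψ₁ , r₁ , m₁ = moveLeft D {Θ ++ x ∷ []} (length-snoc Θ len)
                              (cast (sym (++-assoc Θ (x ∷ []) (D ++ x ∷ D ++ Γ))) r)
      r₂ = appendW Θ len (cast (++-assoc Θ (x ∷ []) (x ∷ D ++ D ++ Γ)) r₁)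
      k , ψ , r₃ , m₃ = contract D {Θ ++ x ∷ []} {Γ} (length-snoc Θ len)
                                  (cast (sym (++-assoc Θ (x ∷ []) (D ++ D ++ Γ))) r₂)
  in k , ψ , cast (++-assoc Θ (x ∷ []) (D ++ Γ)) r₃ , Matches-contract m₁ m₃

++-assoc₃ : ∀ (Θ Δ L R : List Fm) → Θ ++ Δ ++ L ++ R ≡ (Θ ++ Δ ++ L) ++ R
++-assoc₃ Θ Δ L R = sym (trans (++-assoc Θ (Δ ++ L) R) (cong (Θ ++_) (++-assoc Δ L R)))

ImpLTail : ∀ {Δ A Ψ C} → Proof Δ A → Fm → Proof Ψ C → List Fm → List Fm → ℕ → Set
ImpLTail {Δ} {A} {C = C} τ B p Θ Γ t =
  ∃[ k ] ∃[ φ ] TailProof k (Θ ++ Δ ++ (A ⇒ B) ∷ Γ) C (degree τ ⊔ degree p) φ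
              × Matches t (suc (t + length Δ)) (suc t) φ (tiedW p)

ImpLTail-base : ∀ {Δ A Θ B Γ C} {τ : Proof Δ A} {p : Proof (Θ ++ B ∷ Γ) C} →
                Tailless τ → Tailless p → ImpLTail τ B p Θ Γ (length Θ)
ImpLTail-base {τ = τ} {p} tlτ tlp =
  0 , _ , tailProof (impL τ p) (base (Tailless-impL tlτ tlp)) refl (λ _ → refl) , tiedW-impL τ p

ImpLTail-weakΘ : ∀ Θ M {Z Δ A B Γ C t} {τ : Proof Δ A} {p : Proof (Θ ++ Z ∷ Z ∷ M ++ B ∷ Γ) C} →
                 length (Θ ++ Z ∷ M) ≡ t → ImpLTail τ B p (Θ ++ Z ∷ Z ∷ M) Γ (suc t) →
                 ImpLTail τ B (weak {Θ} {Z} {M ++ B ∷ Γ} p) (Θ ++ Z ∷ M) Γ t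
ImpLTail-weakΘ Θ M {Z} {Δ} {A} {B} {Γ} {t = t} {p = p} len (k , φ , r , m) =
  suc k , mergeAt (length Θ) φ
  , cast (sym (++-assoc Θ (Z ∷ M) R)) (appendW Θ refl (cast (++-assoc Θ (Z ∷ Z ∷ M) R) r))
  , Matches-respʳ (λ i → sym (tiedW-weak p refl i)) (Matches-mergeAt-prefix s<a (m<n⇒m<1+n s<t) m)
  where
  R = Δ ++ (A ⇒ B) ∷ Γ
  s<t : length Θ < t
  s<t = subst (length Θ <_) len (length-<-++ Θ)
  s<a : length Θ < suc (t + length Δ)
  s<a = m<n⇒m<1+n (<-≤-trans s<t (m≤m+n t _))

ImpLTail-weakΓ : ∀ Θ M {Z Δ A B Γ C t} {τ : Proof Δ A} {p : Proof ((Θ ++ B ∷ M) ++ Z ∷ Z ∷ Γ) C} →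
                 length Θ ≡ t → ImpLTail τ B p Θ (M ++ Z ∷ Z ∷ Γ) t →
                 ImpLTail τ B (weak {Θ ++ B ∷ M} {Z} {Γ} p) Θ (M ++ Z ∷ Γ) t
ImpLTail-weakΓ Θ M {Z} {Δ} {A} {B} {Γ} {t = t} {p = p} len (k , φ , r , m) =
  suc k , mergeAt (suc (t + d) + length M) φ
  , cast (sym (++-assoc₃ Θ Δ ((A ⇒ B) ∷ M) (Z ∷ Γ)))
      (appendW (Θ ++ Δ ++ (A ⇒ B) ∷ M) lenL (cast (++-assoc₃ Θ Δ ((A ⇒ B) ∷ M) (Z ∷ Z ∷ Γ)) r))
  , Matches-respʳ (λ i → sym (tiedW-weak p (length-++-∷ Θ len) i))
      (Matches-mergeAt-suffix (length M) (≤-trans (m≤m+n t d) (n≤1+n _)) (n≤1+n t) m)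
  where
  d = length Δ
  lenL : length (Θ ++ Δ ++ (A ⇒ B) ∷ M) ≡ suc (t + d) + length M
  lenL = trans (length-++ Θ) (trans (cong₂ _+_ len (length-++ Δ)) (reassoc t d (length M)))
    where
    reassoc : ∀ t d m → t + (d + suc m) ≡ suc (t + d) + m
    reassoc = solve-∀

ImpLTail-weakB : ∀ Θ {Δ A B Γ C t k₁ φ₁} {τ : Proof Δ A} {p : Proof (Θ ++ B ∷ B ∷ Γ) C} →
                 length Θ ≡ t →
                 (r₁ : TailProof k₁ ((Θ ++ B ∷ []) ++ Δ ++ (A ⇒ B) ∷ Γ) C (degree τ ⊔ degree p) φ₁) →
                 Matches (suc t) (suc (suc t + length Δ)) (suc (suc t)) φ₁ (tiedW p) →
                 ImpLTail τ B (proof r₁) Θ (Δ ++ (A ⇒ B) ∷ Γ) t →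
                 ImpLTail τ B (weak {Θ} {B} {Γ} p) Θ Γ t
ImpLTail-weakB Θ {Δ} {A} {B} {Γ} {t = t} {τ = τ} {p} len r₁ m₁ (_ , φ₂ , r₂ , m₂) =
  let k , φ , r , m₃ = contract (Δ ++ x ∷ []) {Θ} {Γ} len (cast (cong (Θ ++_) (sym D++D++Γ)) r₂)
  in k , φ
     , redegree absorb (cast (cong (Θ ++_) (++-assoc Δ (x ∷ []) Γ)) r)
     , Matches-respʳ (λ i → sym (tiedW-weak p len i))
         (Matches-duplicate m₁ (Matches-respʳ (tied≗ r₁) m₂)
           (subst (λ e → Matches t (t + e) (t + (e + e)) φ φ₂) (length-snoc Δ refl) m₃))
  where
  x = A ⇒ B
  D++D++Γ : (Δ ++ x ∷ []) ++ (Δ ++ x ∷ []) ++ Γ ≡ Δ ++ x ∷ Δ ++ x ∷ Γ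
  D++D++Γ = trans (++-assoc Δ (x ∷ []) _) (cong (λ L → Δ ++ x ∷ L) (++-assoc Δ (x ∷ []) Γ))
  absorb : degree τ ⊔ degree (proof r₁) ≡ degree τ ⊔ degree p
  absorb = trans (cong (degree τ ⊔_) (degree≡ r₁))
             (trans (sym (⊔-assoc (degree τ) (degree τ) (degree p))) (cong (_⊔ degree p) (⊔-idem (degree τ))))

impL-rightTail : ∀ m n {Δ A B C Ψ} {τ : Proof Δ A} {p : Proof Ψ C} → Tailless τ → WTailed n p →
                 ∀ Θ Γ {t} → length Θ ≡ t → Ψ ≡ Θ ++ B ∷ Γ → tiedW p t ≤ m →
                 ImpLTail τ B p Θ Γ t
impL-rightTail m zero    tlτ (base tlp) Θ Γ refl refl _ = ImpLTail-base tlτ tlp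
impL-rightTail m (suc n) {Δ} {A} {B} {τ = τ} tlτ (step {Θ = Θ₂} {A = Z} {Γ = Γ₂} {p = p} w)
               Θ Γ {t} len e bound
  with locate Θ₂ Θ e
... | before M refl refl =
  ImpLTail-weakΘ Θ₂ M {τ = τ} {p = p} len
    (impL-rightTail m n tlτ w (Θ₂ ++ Z ∷ Z ∷ M) Γ (trans (length-++-sucʳ Θ₂ Z (Z ∷ M)) (cong suc len))
                    (sym (++-assoc Θ₂ (Z ∷ Z ∷ M) (B ∷ Γ)))
                    (subst (_≤ m) (tiedW-weak-above p (subst (length Θ₂ <_) len (length-<-++ Θ₂))) bound))
... | after M refl refl =
  ImpLTail-weakΓ Θ M {τ = τ} {p = p} len
    (impL-rightTail m n tlτ w Θ (M ++ Z ∷ Z ∷ Γ₂) len (++-assoc Θ (B ∷ M) (Z ∷ Z ∷ Γ₂))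
                    (subst (_≤ m) (tiedW-weak-below p (subst (_< length Θ₂) len (length-<-++ Θ))) bound))
... | here refl refl refl with subst (_≤ m) (tiedW-weak-here p len) bound
-- The (W) contracting B is tied to B, so m > 0 and each copy of B has fewer (W)s tied to it.
...   | s≤s bound′ =
  let _ , _ , r₁ , m₁ = impL-rightTail _ n tlτ w (Θ ++ B ∷ []) Γ (length-snoc Θ len)
                          (sym (++-assoc Θ (B ∷ []) (B ∷ Γ))) (≤-trans (m≤n+m _ _) bound′)
      bound₁ = subst (_≤ _) (sym (trans (tied≗ r₁ t) (prefix m₁ (n<1+n t))))
                     (≤-trans (m≤m+n _ _) bound′)
  in ImpLTail-weakB Θ {τ = τ} {p = p} len r₁ m₁
       (impL-rightTail _ _ tlτ (tail r₁) Θ (Δ ++ (A ⇒ B) ∷ Γ) len (++-assoc Θ (B ∷ []) _) bound₁)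

impL-tails : ∀ {Θ Δ Γ A B C} {π₁ : Proof Δ A} {π₂ : Proof (Θ ++ B ∷ Γ) C} →
             WTail π₁ → WTail π₂ →
             ∃[ k ] ∃[ φ ] TailProof k (Θ ++ Δ ++ (A ⇒ B) ∷ Γ) C (degree π₁ ⊔ degree π₂) φ
                         × Matches (length Θ) (suc (length Θ + length Δ)) (suc (length Θ)) φ (tiedW π₂)
impL-tails {Θ} {Γ = Γ} (base tl) w₂ =
  let n , w = WTail⇒WTailed w₂ in impL-rightTail _ n tl w Θ Γ refl refl ≤-refl
impL-tails {Θ} {Γ = Γ} {A} {B} {π₂ = π₂} (step {Θ = Θ₁} {A = X} {Γ = Γ₁} w₁) w₂ =
  let k , φ , r , m = impL-tails w₁ w₂
  in suc k , mergeAt (t + length Θ₁) φ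
     , cast (sym (reassoc (X ∷ Γ₁))) (appendW (Θ ++ Θ₁) (length-++ Θ) (cast (reassoc (X ∷ X ∷ Γ₁)) r))
     , Matches-mergeAt-left (m≤m+n t _) (+-monoʳ-≤ t (length-++-≤ˡ Θ₁))
         (subst (λ e → Matches t (suc (t + e)) (suc t) φ (tiedW π₂)) (length-++-sucʳ Θ₁ X (X ∷ Γ₁)) m)
  where
  t = length Θ
  reassoc : ∀ L → Θ ++ (Θ₁ ++ L) ++ (A ⇒ B) ∷ Γ ≡ (Θ ++ Θ₁) ++ L ++ (A ⇒ B) ∷ Γ
  reassoc L = trans (cong (Θ ++_) (++-assoc Θ₁ L _)) (sym (++-assoc Θ Θ₁ _))

lemma5p4 : (Θ Δ Γ : List Fm) (A B C : Fm)
    (π₁ : Proof Δ A) (π₂ : Proof (Θ ++ B ∷ Γ) C) →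
    WTail π₁ → WTail π₂ →
    Σ (Proof (Θ ++ Δ ++ (A ⇒ B) ∷ Γ) C) (λ π →
      WNormal π × WTail π
      × degree π ≡ degree (impL {Δ} {A} {Θ} {B} {Γ} {C} π₁ π₂)
      × ((i : ℕ) → i < length Θ → tiedW π i ≡ tiedW π₂ i)
      × ((j : ℕ) → j < length Γ →
           tiedW π (length Θ + length Δ + suc j) ≡ tiedW π₂ (length Θ + suc j)))
lemma5p4 Θ Δ Γ A B C π₁ π₂ w₁ w₂ =
  let _ , φ , r , m = impL-tails {Θ} {Δ} {Γ} {A} {B} {C} w₁ w₂
      π = proof r
  in π , WTailed⇒WN (tail r) , WTailed⇒WTail (tail r) , degree≡ r
     , (λ i i<t → trans (tied≗ r i) (prefix m i<t))
     , λ j _ → begin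
         tiedW π (length Θ + length Δ + suc j)   ≡⟨ cong (tiedW π) (+-suc (length Θ + length Δ) j) ⟩
         tiedW π (suc (length Θ + length Δ) + j) ≡⟨ tied≗ r _ ⟩
         φ (suc (length Θ + length Δ) + j)       ≡⟨ suffix m j ⟩
         tiedW π₂ (suc (length Θ) + j)           ≡⟨ cong (tiedW π₂) (+-suc (length Θ) j) ⟨
         tiedW π₂ (length Θ + suc j)             ∎
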